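{- Let $A$ be a string over $\{0,1,2\}$ all of whose runs have length at most $7$. Then for every $n\ge 2$, the string $A_n$ contains no two consecutive $0$'s, no four consecutive $2$'s, and no five consecutive $1$'s.
   Context: A run is a maximal block of consecutive equal digits. The base-3 look-and-say operation sends a string $A$, written as its runs $r_1\cdots r_k$ with $r_i$ consisting of $n_i$ copies of the digit $d_i$, to the string $A_1$ obtained by replacing each $r_i$ by the base-3 representation of $n_i$ (no leading zeros) followed by $d_i$, and concatenating; $A_0=A$, $A_{n+1}=(A_n)_1$. -}

module Defs where

open import Data.Nat using (ℕ; zero; suc; _≤_)
open import Data.Nat.DivMod using (_/_; _%_; m%n<n)
open import Data.Fin using (Fin; fromℕ<; _≟_)
open import Data.Product using (_×_; _,_; proj₂)
open import Data.List using (List; []; _∷_; _++_; reverse; concatMap; map; length)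
open import Data.List.Relation.Unary.All using (All)
open import Relation.Nullary using (yes; no)

Digit : Set
Digit = Fin 3

Str : Set
Str = List Digit

runs : Str → List (Digit × ℕ)
runs [] = []
runs (d ∷ xs) with runs xs
... | [] = (d , 1) ∷ []
... | (e , k) ∷ rs with d ≟ e
...   | yes _ = (e , suc k) ∷ rs
...   | no _  = (d , 1) ∷ (e , k) ∷ rs

-- Base-3 digits of n, least significant first, using fuel (fuel ≥ n suffices).
base3-rev : ℕ → ℕ → Str
base3-rev zero    n = []
base3-rev (suc f) zero = []
base3-rev (suc f) (suc n) = fromℕ< (m%n<n (suc n) 3) ∷ base3-rev f (suc n / 3)

-- Base-3 representation of n, most significant digit first, no leading
-- zeros (empty for n = 0, which never occurs as a run length).
base3 : ℕ → Str
base3 n = reverse (base3-rev n n)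

lookSay : Str → Str
lookSay A = concatMap (λ r → base3 (proj₂ r) ++ (Data.Product.proj₁ r ∷ [])) (runs A)

lookSay^ : ℕ → Str → Str
lookSay^ zero    A = A
lookSay^ (suc n) A = lookSay (lookSay^ n A)

RunsAtMost7 : Str → Set
RunsAtMost7 A = All (λ r → proj₂ r ≤ 7) (runs A)

open import Data.Product using (∃₂)
open import Relation.Binary.PropositionalEquality using (_≡_)

Factor : Str → Str → Set
Factor w s = ∃₂ λ u v → s ≡ u ++ w ++ v

{-# OPTIONS --safe #-}
module Submission where

-- The runs of A₁ are obtained from those of A by expanding each run (d , k)
-- into the block base3 k ++ [ d ] and re-reading the concatenation. Going
-- from right to left, a block only interacts with the first run of what has
-- already been built, so bounds on run lengths (per digit) propagate by a
-- finite check, provided we also bound that first run in terms of the digit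
-- of the run that produced it. Runs of length ≤ 7 thus give runs of lengths
-- ≤ 2, 5, 3 (for the digits 0, 1, 2) after one step, and those give lengths
-- ≤ 1, 4, 3, which are again within 2, 5, 3. A run of 00, 2222 or 11111
-- exceeds these bounds.

open import Defs
open import Data.Nat using (ℕ; zero; suc; _+_; _≤_; _<_; z≤n; s≤s; z<s)
open import Data.Nat.Properties
  using (_≤?_; ≤-trans; n≤1+n; m≤m+n; n≮n; allUpTo?; module ≤-Reasoning)
open import Data.Fin using (zero; suc; _≟_)
open import Data.Fin.Patterns using (0F; 1F; 2F)
open import Data.Fin.Properties using (all?)
open import Data.List using (List; []; _∷_; _++_; foldr; concatMap; replicate; head)
open import Data.List.Relation.Unary.All as All using (All; []; _∷_)
open import Data.List.Relation.Unary.All.Properties using (++⁺)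
open import Data.List.Relation.Unary.Linked using (Linked; []; [-]; _∷_)
import Data.Maybe.Relation.Unary.Any as Maybe
open import Data.Product using (_×_; _,_; proj₁; proj₂)
open import Function using (_on_; _∘_)
open import Relation.Nullary using (¬_; Dec; yes; no)
open import Relation.Nullary.Decidable using (¬?; _×-dec_; _→-dec_; from-yes)
open import Relation.Binary.PropositionalEquality
  using (_≡_; _≢_; refl; sym; trans; cong; subst; ≡-≟-identity)

Run : Set
Run = Digit × ℕ

consRun : Digit → List Run → List Run
consRun d [] = (d , 1) ∷ []
consRun d ((e , k) ∷ rs) with d ≟ e
... | yes _ = (e , suc k) ∷ rs
... | no _  = (d , 1) ∷ (e , k) ∷ rs

runs-∷ : ∀ d xs → runs (d ∷ xs) ≡ consRun d (runs xs)
runs-∷ d xs with runs xs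
... | [] = refl
... | (e , k) ∷ rs with d ≟ e
...   | yes _ = refl
...   | no _  = refl

prependRuns : Str → List Run → List Run
prependRuns w R = foldr consRun R w

runs-++ : ∀ xs ys → runs (xs ++ ys) ≡ prependRuns xs (runs ys)
runs-++ []       ys = refl
runs-++ (x ∷ xs) ys = trans (runs-∷ x (xs ++ ys)) (cong (consRun x) (runs-++ xs ys))

consRun-≢[] : ∀ d R → consRun d R ≢ []
consRun-≢[] d [] ()
consRun-≢[] d ((e , k) ∷ rs) with d ≟ e
... | yes _ = λ ()
... | no _  = λ ()

prependRuns-≢[] : ∀ w {R} → R ≢ [] → prependRuns w R ≢ []
prependRuns-≢[] []      R≢[] = R≢[]
prependRuns-≢[] (x ∷ w) {R} _ = consRun-≢[] x (prependRuns w R)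

consRun-++ : ∀ d {R} R′ → R ≢ [] → consRun d (R ++ R′) ≡ consRun d R ++ R′
consRun-++ d {[]}          R′ R≢[] with () ← R≢[] refl
consRun-++ d {(e , k) ∷ R} R′ _ with d ≟ e
... | yes _ = refl
... | no _  = refl

prependRuns-++ : ∀ w {R} R′ → R ≢ [] → prependRuns w (R ++ R′) ≡ prependRuns w R ++ R′
prependRuns-++ []      R′ _    = refl
prependRuns-++ (x ∷ w) R′ R≢[] =
  trans (cong (consRun x) (prependRuns-++ w R′ R≢[])) (consRun-++ x R′ (prependRuns-≢[] w R≢[]))

consRun-linked : ∀ d {R} → Linked (_≢_ on proj₁) R → Linked (_≢_ on proj₁) (consRun d R)
consRun-linked d {[]}           _ = [-]
consRun-linked d {(e , k) ∷ rs} l with d ≟ e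
... | no d≢e = d≢e ∷ l
... | yes _  with l
...   | [-]   = [-]
...   | p ∷ l′ = p ∷ l′

runs-linked : ∀ S → Linked (_≢_ on proj₁) (runs S)
runs-linked []       = []
runs-linked (d ∷ xs) = subst (Linked _) (sym (runs-∷ d xs)) (consRun-linked d (runs-linked xs))

consRun-positive : ∀ d {R} → All ((0 <_) ∘ proj₂) R → All ((0 <_) ∘ proj₂) (consRun d R)
consRun-positive d {[]}           _ = z<s ∷ []
consRun-positive d {(e , k) ∷ rs} p with d ≟ e
... | yes _ = z<s ∷ All.tail p
... | no _  = z<s ∷ p

runs-positive : ∀ S → All ((0 <_) ∘ proj₂) (runs S)
runs-positive []       = []
runs-positive (d ∷ xs) = subst (All _) (sym (runs-∷ d xs)) (consRun-positive d (runs-positive xs))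

block : Run → Str
block r = base3 (proj₂ r) ++ proj₁ r ∷ []

lookSayRuns : List Run → List Run
lookSayRuns []      = []
lookSayRuns (r ∷ R) = prependRuns (block r) (lookSayRuns R)

runs-lookSay : ∀ S → runs (lookSay S) ≡ lookSayRuns (runs S)
runs-lookSay S = go (runs S)
  where
  go : ∀ R → runs (concatMap block R) ≡ lookSayRuns R
  go []      = refl
  go (r ∷ R) = trans (runs-++ (block r) _) (cong (prependRuns (block r)) (go R))

RunWithin : (Digit → ℕ) → Run → Set
RunWithin b r = proj₂ r ≤ b (proj₁ r)

runWithin? : ∀ b r → Dec (RunWithin b r)
runWithin? b r = proj₂ r ≤? b (proj₁ r)

Bounded : (Digit → ℕ) → List Run → Set
Bounded b = All (RunWithin b)

HeadBounded : (Digit → ℕ) → List Run → Set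
HeadBounded b R = Maybe.Any (RunWithin b) (head R)

BoundedWithHead : (Digit → ℕ) → (Digit → ℕ) → List Run → Set
BoundedWithHead b h R = Bounded b R × HeadBounded h R

boundedWithHead? : ∀ b h R → Dec (BoundedWithHead b h R)
boundedWithHead? b h R = All.all? (runWithin? b) R ×-dec Maybe.dec (runWithin? h) (head R)

BoundedWithHead-++ : ∀ {b h} R {R′} → BoundedWithHead b h R → Bounded b R′ →
                     BoundedWithHead b h (R ++ R′)
BoundedWithHead-++ (_ ∷ _) (bR , hR) bR′ = ++⁺ bR bR′ , hR

Bounded-mono : ∀ {b b′} → (∀ d → b d ≤ b′ d) → ∀ {R} → Bounded b R → Bounded b′ R
Bounded-mono b≤b′ = All.map λ {r} k≤ → ≤-trans k≤ (b≤b′ (proj₁ r))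

leading : Digit → List Run → ℕ
leading d [] = 0
leading d ((e , k) ∷ _) with d ≟ e
... | yes _ = k
... | no _  = 0

leading-consRun : ∀ d R → leading d (consRun d R) ≡ suc (leading d R)
leading-consRun d [] rewrite ≡-≟-identity _≟_ {d} refl = refl
leading-consRun d ((e , k) ∷ rs) with d ≟ e
... | yes refl rewrite ≡-≟-identity _≟_ {d} refl = refl
... | no _     rewrite ≡-≟-identity _≟_ {d} refl = refl

leading-prependRuns-replicate : ∀ m d R →
  leading d (prependRuns (replicate m d) R) ≡ m + leading d R
leading-prependRuns-replicate zero    d R = refl
leading-prependRuns-replicate (suc m) d R =
  trans (leading-consRun d (prependRuns (replicate m d) R))
        (cong suc (leading-prependRuns-replicate m d R))

leading-bounded : ∀ {b} d {R} → Bounded b R → leading d R ≤ b d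
leading-bounded d {[]}          _ = z≤n
leading-bounded d {(e , k) ∷ _} (k≤ ∷ _) with d ≟ e
... | yes refl = k≤
... | no _     = z≤n

Bounded-consRun⁻ : ∀ {b} d R → Bounded b (consRun d R) → Bounded b R
Bounded-consRun⁻ d [] _ = []
Bounded-consRun⁻ d ((e , k) ∷ rs) bnd with d ≟ e | bnd
... | yes _ | sk≤ ∷ bnd′ = ≤-trans (n≤1+n k) sk≤ ∷ bnd′
... | no _  | _ ∷ bnd′   = bnd′

Bounded-prependRuns⁻ : ∀ {b} w R → Bounded b (prependRuns w R) → Bounded b R
Bounded-prependRuns⁻ []      R bnd = bnd
Bounded-prependRuns⁻ (x ∷ w) R bnd =
  Bounded-prependRuns⁻ w R (Bounded-consRun⁻ x (prependRuns w R) bnd)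

Bounded-runs-suffix : ∀ {b} u {w} → Bounded b (runs (u ++ w)) → Bounded b (runs w)
Bounded-runs-suffix u {w} bnd =
  Bounded-prependRuns⁻ u (runs w) (subst (Bounded _) (runs-++ u w) bnd)

leading-runs-replicate : ∀ m d v → m ≤ leading d (runs (replicate m d ++ v))
leading-runs-replicate m d v = begin
  m                                                 ≤⟨ m≤m+n m (leading d (runs v)) ⟩
  m + leading d (runs v)                            ≡⟨ leading-prependRuns-replicate m d (runs v) ⟨
  leading d (prependRuns (replicate m d) (runs v))  ≡⟨ cong (leading d) (runs-++ (replicate m d) v) ⟨
  leading d (runs (replicate m d ++ v))             ∎
  where open ≤-Reasoning

no-long-run : ∀ {b s} d → Bounded b (runs s) → ¬ Factor (replicate (suc (b d)) d) s
no-long-run {b} d bnd (u , v , refl) =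
  n≮n (b d) (≤-trans (leading-runs-replicate (suc (b d)) d v)
                     (leading-bounded d (Bounded-runs-suffix u bnd)))

-- Invariant of the right-to-left expansion: hb d bounds the first run of the
-- expansion of a run list starting with digit d. The block in front of it ends
-- in a digit other than d, which is why the bound may depend on d.
BlockBounded : (bin bout : Digit → ℕ) → (Digit → Digit → ℕ) → Set
BlockBounded bin bout hb =
  ∀ d {k} → k < bin d → BoundedWithHead bout (hb d) (prependRuns (block (d , suc k)) [])

BlockThenHeadBounded : (bin bout : Digit → ℕ) → (Digit → Digit → ℕ) → Set
BlockThenHeadBounded bin bout hb =
  ∀ d d′ e → d ≢ d′ → ∀ {k} → k < bin d → ∀ {n} → n < suc (hb d′ e) →
  BoundedWithHead bout (hb d) (prependRuns (block (d , suc k)) ((e , n) ∷ []))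

blockBounded? : ∀ bin bout hb → Dec (BlockBounded bin bout hb)
blockBounded? bin bout hb = all? λ d →
  allUpTo? (λ k → boundedWithHead? bout (hb d) (prependRuns (block (d , suc k)) [])) (bin d)

blockThenHeadBounded? : ∀ bin bout hb → Dec (BlockThenHeadBounded bin bout hb)
blockThenHeadBounded? bin bout hb = all? λ d → all? λ d′ → all? λ e → ¬? (d ≟ d′) →-dec
  allUpTo? (λ k → allUpTo? (λ n →
    boundedWithHead? bout (hb d) (prependRuns (block (d , suc k)) ((e , n) ∷ [])))
    (suc (hb d′ e))) (bin d)

module _ {bin bout : Digit → ℕ} (hb : Digit → Digit → ℕ)
         (block-bounded : BlockBounded bin bout hb)
         (block-then-head-bounded : BlockThenHeadBounded bin bout hb) where

  lookSayRuns-∷-bounded : ∀ d k R → Linked (_≢_ on proj₁) ((d , k) ∷ R) →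
    All ((0 <_) ∘ proj₂) ((d , k) ∷ R) → Bounded bin ((d , k) ∷ R) →
    BoundedWithHead bout (hb d) (lookSayRuns ((d , k) ∷ R))
  lookSayRuns-∷-bounded d zero    _ _ (() ∷ _) _
  lookSayRuns-∷-bounded d (suc k) [] _ _ (k<b ∷ []) = block-bounded d k<b
  lookSayRuns-∷-bounded d (suc k) ((d′ , k′) ∷ R) (d≢d′ ∷ lnk) (_ ∷ pos) (k<b ∷ bnd)
    with lookSayRuns ((d′ , k′) ∷ R) | lookSayRuns-∷-bounded d′ k′ R lnk pos bnd
  ... | (e , n) ∷ R′ | bR′ , Maybe.just n≤ =
    subst (BoundedWithHead bout (hb d)) (sym (prependRuns-++ (block (d , suc k)) R′ λ ()))
      (BoundedWithHead-++ _ (block-then-head-bounded d d′ e d≢d′ k<b (s≤s n≤)) (All.tail bR′))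

  lookSayRuns-bounded : ∀ R → Linked (_≢_ on proj₁) R → All ((0 <_) ∘ proj₂) R →
    Bounded bin R → Bounded bout (lookSayRuns R)
  lookSayRuns-bounded []            _   _   _   = []
  lookSayRuns-bounded ((d , k) ∷ R) lnk pos bnd = proj₁ (lookSayRuns-∷-bounded d k R lnk pos bnd)

  lookSay-bounded : ∀ S → Bounded bin (runs S) → Bounded bout (runs (lookSay S))
  lookSay-bounded S bnd = subst (Bounded bout) (sym (runs-lookSay S))
    (lookSayRuns-bounded (runs S) (runs-linked S) (runs-positive S) bnd)

runBound₁ : Digit → ℕ
runBound₁ 0F = 2
runBound₁ 1F = 5
runBound₁ 2F = 3

runBound₂ : Digit → ℕ
runBound₂ 0F = 1
runBound₂ 1F = 4
runBound₂ 2F = 3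

runBound₂≤runBound₁ : ∀ d → runBound₂ d ≤ runBound₁ d
runBound₂≤runBound₁ = from-yes (all? λ d → runBound₂ d ≤? runBound₁ d)

-- The least head bounds passing the checks. An expansion starts with the
-- leading base-3 digit of a run length, so never with 0.
headBound₁ : Digit → Digit → ℕ
headBound₁ _  0F = 0
headBound₁ 1F 1F = 5
headBound₁ _  1F = 2
headBound₁ 2F 2F = 3
headBound₁ _  2F = 1

headBound₂ : Digit → Digit → ℕ
headBound₂ _  0F = 0
headBound₂ 1F 1F = 4
headBound₂ _  1F = 1
headBound₂ 2F 2F = 3
headBound₂ _  2F = 1

lookSay-bounded₁ : ∀ S → Bounded (λ _ → 7) (runs S) → Bounded runBound₁ (runs (lookSay S))
lookSay-bounded₁ = lookSay-bounded headBound₁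
  (from-yes (blockBounded? (λ _ → 7) runBound₁ headBound₁))
  (from-yes (blockThenHeadBounded? (λ _ → 7) runBound₁ headBound₁))

lookSay-bounded₂ : ∀ S → Bounded runBound₁ (runs S) → Bounded runBound₂ (runs (lookSay S))
lookSay-bounded₂ = lookSay-bounded headBound₂
  (from-yes (blockBounded? runBound₁ runBound₂ headBound₂))
  (from-yes (blockThenHeadBounded? runBound₁ runBound₂ headBound₂))

lookSay^-bounded : ∀ A → RunsAtMost7 A → ∀ n → 2 ≤ n → Bounded runBound₂ (runs (lookSay^ n A))
lookSay^-bounded A h 1                   (s≤s ())
lookSay^-bounded A h 2                   _ = lookSay-bounded₂ (lookSay A) (lookSay-bounded₁ A h)
lookSay^-bounded A h (suc (suc (suc n))) _ = lookSay-bounded₂ (lookSay^ (suc (suc n)) A)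
  (Bounded-mono runBound₂≤runBound₁ (lookSay^-bounded A h (suc (suc n)) (s≤s (s≤s z≤n))))

lemma3 : (A : Str) → RunsAtMost7 A → (n : ℕ) → 2 ≤ n →
    ¬ Factor (zero ∷ zero ∷ []) (lookSay^ n A)
    × ¬ Factor (suc (suc zero) ∷ suc (suc zero) ∷ suc (suc zero) ∷ suc (suc zero) ∷ []) (lookSay^ n A)
    × ¬ Factor (suc zero ∷ suc zero ∷ suc zero ∷ suc zero ∷ suc zero ∷ []) (lookSay^ n A)
lemma3 A h n 2≤n = no-long-run 0F bnd , no-long-run 2F bnd , no-long-run 1F bnd
  where
  bnd : Bounded runBound₂ (runs (lookSay^ n A))
  bnd = lookSay^-bounded A h n 2≤n
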